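{- Let $D(x_1,\ldots,x_p)\in\mathbb{Z}[x_1,\ldots,x_p]$ with $\deg(D,x_i)\geqslant 1$ for each $i\in\{1,\ldots,p\}$. One can compute a positive integer $n>p$ and a system $T\subseteq G_n$ such that for every $\mathbf{K}$ which is either a ring extending $\mathbb{Z}$, or $\mathbb{N}$, or $\mathbb{N}\setminus\{0\}$: (i) for all $\tilde{x}_1,\ldots,\tilde{x}_p\in\mathbf{K}$, $D(\tilde{x}_1,\ldots,\tilde{x}_p)=0$ if and only if there exist $\tilde{x}_{p+1},\ldots,\tilde{x}_n\in\mathbf{K}$ such that $(\tilde{x}_1,\ldots,\tilde{x}_n)$ solves $T$; (ii) for each $\tilde{x}_1,\ldots,\tilde{x}_p\in\mathbf{K}$ with $D(\tilde{x}_1,\ldots,\tilde{x}_p)=0$ there exists a unique tuple $(\tilde{x}_{p+1},\ldots,\tilde{x}_n)\in\mathbf{K}^{n-p}$ such that $(\tilde{x}_1,\ldots,\tilde{x}_n)$ solves $T$. In particular, for each such $\mathbf{K}$ the equation $D(x_1,\ldots,x_p)=0$ and the system $T$ have the same number of solutions in $\mathbf{K}$.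
   Context: For a positive integer $n$, $G_n=\{x_i+1=x_k: i,k \in \{1,\ldots,n\}\} \cup \{x_i \cdot x_j=x_k: i,j,k \in \{1,\ldots,n\}\}$; a system $T\subseteq G_n$ is a set of such equations in the variables $x_1,\ldots,x_n$. $\deg(D,x_i)$ is the degree of $D$ in the variable $x_i$. A ring extending $\mathbb{Z}$ means a commutative ring with identity containing $\mathbb{Z}$ as a subring. -}

module Defs where

open import Level using (Level; _⊔_)
open import Data.Nat as ℕ using (ℕ; zero; suc; _≤_; _<_)
open import Data.Integer as ℤ using (ℤ; +_; -[1+_])
open import Data.Fin using (Fin; zero; suc; inject≤)
open import Data.Vec using (Vec; lookup; tail)
open import Data.List using (List; map; foldr)
open import Data.List.Relation.Unary.All using (All)
open import Data.List.Relation.Unary.Any using (Any)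
open import Data.List.Relation.Unary.Unique.Propositional using (Unique)
open import Data.Product using (Σ; _×_; _,_)
open import Data.Unit using (⊤)
open import Data.Nat.Properties using (<⇒≤)
open import Agda.Primitive using (Setω)
open import Function.Bundles using (_⇔_)
open import Relation.Binary.PropositionalEquality using (_≡_; _≢_)
open import Algebra.Bundles using (CommutativeRing)

record Monomial (p : ℕ) : Set where
  constructor mono
  field
    coeff : ℤ
    exps  : Vec ℕ p
open Monomial public

record Poly (p : ℕ) : Set where
  field
    monos    : List (Monomial p)
    nonzero  : All (λ m → coeff m ≢ + 0) monos
    distinct : Unique (map exps monos)
open Poly public

-- deg(D, x_i): maximum exponent of x_i over the monomials of D
-- (0 for the zero polynomial).
deg : ∀ {p} → Poly p → Fin p → ℕ
deg D i = foldr (λ m d → ℕ._⊔_ (lookup (exps m) i) d) 0 (monos D)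

module Eval {a} {A : Set a} (0# 1# : A) (_+_ _*_ : A → A → A) (ι : ℤ → A) where

  pow : A → ℕ → A
  pow x zero    = 1#
  pow x (suc e) = x * pow x e

  monoProd : ∀ {p} → Vec ℕ p → (Fin p → A) → A
  monoProd {zero}  _ _ = 1#
  monoProd {suc p} es x =
    pow (x zero) (lookup es zero) * monoProd (tail es) (λ j → x (suc j))

  evalMono : ∀ {p} → Monomial p → (Fin p → A) → A
  evalMono m x = ι (coeff m) * monoProd (exps m) x

  eval : ∀ {p} → Poly p → (Fin p → A) → A
  eval D x = foldr (λ m s → evalMono m x + s) 0# (monos D)

data Equation (n : ℕ) : Set where
  addOne : (i k : Fin n) → Equation n
  mul    : (i j k : Fin n) → Equation n

System : ℕ → Set
System n = List (Equation n)

module Solves {a ℓ} {A : Set a} (_≈_ : A → A → Set ℓ)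
              (1# : A) (_+_ _*_ : A → A → A) where

  holds : ∀ {n} → (Fin n → A) → Equation n → Set ℓ
  holds x (addOne i k) = (x i + 1#) ≈ x k
  holds x (mul i j k)  = (x i * x j) ≈ x k

  solves : ∀ {n} → (Fin n → A) → System n → Set ℓ
  solves x T = All (holds x) T

-- Rings extending ℤ: the canonical ring map ℤ → R is injective
-- (equivalently, ℤ is a subring of R).

module _ {c ℓ} (R : CommutativeRing c ℓ) where
  open CommutativeRing R

  natR : ℕ → Carrier
  natR zero    = 0#
  natR (suc n) = 1# + natR n

  intR : ℤ → Carrier
  intR (+ n)      = natR n
  intR -[1+ n ]   = - natR (suc n)

  ExtendsℤRing : Set ℓ
  ExtendsℤRing = ∀ a b → intR a ≈ intR b → a ≡ b

-- Generic form of properties (i) and (ii) for a domain K, given as a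
-- carrier A with equality _≈_ and a membership predicate inK (K ⊆ A).

module _ {a ℓ k r s} {A : Set a} (_≈_ : A → A → Set ℓ) (inK : A → Set k)
         {p n : ℕ} (emb : Fin p → Fin n)
         (isRoot : (Fin p → A) → Set r)
         (solvesT : (Fin n → A) → Set s)
         where

  InK : ∀ {m} → (Fin m → A) → Set k
  InK x = ∀ i → inK (x i)

  Extends : (Fin p → A) → (Fin n → A) → Set ℓ
  Extends x y = ∀ i → y (emb i) ≈ x i

  PropertyI : Set _
  PropertyI = ∀ (x : Fin p → A) → InK x →
    (isRoot x ⇔ Σ (Fin n → A) λ y → InK y × Extends x y × solvesT y)

  PropertyII : Set _
  PropertyII = ∀ (x : Fin p → A) → InK x → isRoot x →
    Σ (Fin n → A) λ y → (InK y × Extends x y × solvesT y) ×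
      (∀ (y′ : Fin n → A) → InK y′ → Extends x y′ → solvesT y′ →
        ∀ j → y j ≈ y′ j)

  Correct : Set _
  Correct = PropertyI × PropertyII

record Lemma4Conclusion (p : ℕ) (D : Poly p) : Setω where
  field
    n   : ℕ
    p<n : p < n
    T   : System n

  emb : Fin p → Fin n
  emb i = inject≤ i (<⇒≤ p<n)

  -- K = ℕ or ℕ ∖ {0}: D is evaluated in ℤ at the images of the
  -- natural numbers; T is interpreted in ℕ.
  private
    module Eℤ = Eval (+ 0) (+ 1) ℤ._+_ ℤ._*_ (λ z → z)
    module Sℕ = Solves _≡_ 1 ℕ._+_ ℕ._*_

  rootℕ : (Fin p → ℕ) → Set
  rootℕ x = Eℤ.eval D (λ i → + (x i)) ≡ + 0

  field
    forRings : ∀ {c ℓ} (R : CommutativeRing c ℓ) → ExtendsℤRing R →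
      let open CommutativeRing R
          module E = Eval 0# 1# _+_ _*_ (intR R)
          module S = Solves _≈_ 1# _+_ _*_
      in Correct _≈_ (λ _ → ⊤) emb
                 (λ x → E.eval D x ≈ 0#) (λ y → S.solves y T)
    forℕ : Correct _≡_ (λ _ → ⊤) emb rootℕ (λ y → Sℕ.solves y T)
    forℕ⁺ : Correct _≡_ (λ m → 1 ≤ m) emb rootℕ (λ y → Sℕ.solves y T)

{-# OPTIONS --safe #-}
module Submission where

-- The system T is read off a straight-line program that, starting from
-- x₁,…,x_p, evaluates D.  Besides x_i + 1 = x_k and x_i·x_j = x_k, such a
-- program needs the constant 1 and addition.  The constant is a fresh o
-- with o·o = o, o + 1 = t and o·t = t, which force o = 1.  A sum z = x + y
-- is a fresh z constrained by
--   z²(xy + 1) + 1 = (xz + 1)(yz + 1)   and the same for (x + 1, y, z + 1),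
-- which expand to z² = z(x + y) and (z + 1)² = (z + 1)(x + y + 1), hence
-- z = x + y.  Splitting D = P − N into parts with nonnegative coefficients,
-- the program accumulates 1 + P and 1 + N and the last equation says
-- (1 + P)·o = 1 + N.  In a commutative ring every solution of T is thus
-- the run of the program, which gives existence and uniqueness at once;
-- ℕ and ℕ ∖ {0} are handled inside ℤ, since the run stays in any subset
-- of ℤ containing 1 and closed under + and ·.

open import Defs
open import Data.Nat as ℕ using (ℕ; zero; suc; _≤_; _<_; _∸_; _<ᵇ_; _<?_; z≤n; s≤s)
open import Data.Nat.Properties
  using (≤-refl; ≤-trans; <-trans; <-≤-trans; <⇒≤; m≤m+n; m<m+n; +-monoʳ-<; +-cancelˡ-<; *-mono-≤;
         m+n≮m; m+n∸m≡n; m+[n∸m]≡n; ≮⇒≥; <⇒<ᵇ; <ᵇ⇒<)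
open import Data.Integer as ℤ using (ℤ; +_; -[1+_])
open import Data.Integer.Properties using (+-*-commutativeRing; pos-+; pos-*; +-injective)
open import Data.Fin as Fin using (Fin; toℕ; fromℕ<; inject≤)
open import Data.Fin.Properties using (toℕ<n; toℕ-fromℕ<; toℕ-injective; toℕ-inject≤)
open import Data.Vec using (Vec; lookup; tail)
open import Data.Bool using (T)
open import Data.List using (List; []; _∷_; _++_; map; foldr)
open import Data.List.Relation.Unary.All as All using (All; []; _∷_)
import Data.List.Relation.Unary.All.Properties as All
open import Data.Product using (Σ; _×_; _,_; proj₁; proj₂)
open import Data.Unit using (⊤; tt)
open import Function using (_∘_)
open import Function.Bundles using (_⇔_; mk⇔; Equivalence)
import Function.Properties.Equivalence as ⇔
open import Relation.Nullary using (yes; no)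
open import Relation.Nullary.Negation using (contradiction)
open import Relation.Binary.PropositionalEquality as ≡ using (_≡_; cong)
open import Algebra.Bundles using (CommutativeRing)

-- Straight-line programs

data Expr : Set where
  X Y Z one : Expr
  _⊕_ _⊗_   : Expr → Expr → Expr

infixl 6 _⊕_
infixl 7 _⊗_

data Equationℕ : Set where
  addOneℕ : (i k : ℕ) → Equationℕ
  mulℕ    : (i j k : ℕ) → Equationℕ

-- A block appended after the variables 0,…,c−1 introduces the variables
-- c, c+1, … (as many as its size): the constants 1, 2, a product, or a sum.
data Block (c : ℕ) : Set where
  unit     : Block c
  prod sum : (i j : ℕ) → i < c → j < c → Block c

size : ∀ {c} → Block c → ℕ
size unit           = 2
size (prod _ _ _ _) = 1
size (sum _ _ _ _)  = 21

operandˡ operandʳ : ∀ {c} → Block c → ℕ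
operandˡ unit           = 0
operandˡ (prod i _ _ _) = i
operandˡ (sum i _ _ _)  = i
operandʳ unit           = 0
operandʳ (prod _ j _ _) = j
operandʳ (sum _ j _ _)  = j

-- Variable r of the sum gadget, in terms of its operands X, Y and the
-- guess Z (variable 0).  Variables 1–9 evaluate the first check for
-- (X, Y, Z) and variables 10–20 the same check for (X + 1, Y, Z + 1).
sumVar : ℕ → Expr
sumVar 0  = Z
sumVar 1  = X ⊗ sumVar 0
sumVar 2  = sumVar 1 ⊕ one
sumVar 3  = Y ⊗ sumVar 0
sumVar 4  = sumVar 3 ⊕ one
sumVar 5  = sumVar 2 ⊗ sumVar 4
sumVar 6  = sumVar 0 ⊗ sumVar 0
sumVar 7  = X ⊗ Y
sumVar 8  = sumVar 7 ⊕ one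
sumVar 9  = sumVar 6 ⊗ sumVar 8
sumVar 10 = sumVar 0 ⊕ one
sumVar 11 = X ⊕ one
sumVar 12 = sumVar 11 ⊗ sumVar 10
sumVar 13 = sumVar 12 ⊕ one
sumVar 14 = Y ⊗ sumVar 10
sumVar 15 = sumVar 14 ⊕ one
sumVar 16 = sumVar 13 ⊗ sumVar 15
sumVar 17 = sumVar 10 ⊗ sumVar 10
sumVar 18 = sumVar 11 ⊗ Y
sumVar 19 = sumVar 18 ⊕ one
sumVar 20 = sumVar 17 ⊗ sumVar 19
sumVar _  = one

blockExpr : ∀ {c} → Block c → ℕ → Expr
blockExpr unit zero        = one
blockExpr unit (suc _)     = one ⊕ one
blockExpr (prod _ _ _ _) _ = X ⊗ Y
blockExpr (sum _ _ _ _)  r = sumVar r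

-- The r-th equation defines variable r of the gadget; the last two are the checks.
sumEquations : (i j c : ℕ) → List Equationℕ
sumEquations i j c =
  mulℕ i (v 0) (v 1) ∷ addOneℕ (v 1) (v 2) ∷ mulℕ j (v 0) (v 3) ∷ addOneℕ (v 3) (v 4) ∷
  mulℕ (v 2) (v 4) (v 5) ∷ mulℕ (v 0) (v 0) (v 6) ∷ mulℕ i j (v 7) ∷ addOneℕ (v 7) (v 8) ∷
  mulℕ (v 6) (v 8) (v 9) ∷ addOneℕ (v 0) (v 10) ∷ addOneℕ i (v 11) ∷ mulℕ (v 11) (v 10) (v 12) ∷
  addOneℕ (v 12) (v 13) ∷ mulℕ j (v 10) (v 14) ∷ addOneℕ (v 14) (v 15) ∷ mulℕ (v 13) (v 15) (v 16) ∷
  mulℕ (v 10) (v 10) (v 17) ∷ mulℕ (v 11) j (v 18) ∷ addOneℕ (v 18) (v 19) ∷ mulℕ (v 17) (v 19) (v 20) ∷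
  addOneℕ (v 9) (v 5) ∷ addOneℕ (v 20) (v 16) ∷ []
  where
  v : ℕ → ℕ
  v r = c ℕ.+ r

blockEquations : (c : ℕ) → Block c → List Equationℕ
blockEquations c unit =
  mulℕ (c ℕ.+ 0) (c ℕ.+ 0) (c ℕ.+ 0) ∷ addOneℕ (c ℕ.+ 0) (c ℕ.+ 1) ∷
  mulℕ (c ℕ.+ 0) (c ℕ.+ 1) (c ℕ.+ 1) ∷ []
blockEquations c (prod i j _ _) = mulℕ i j (c ℕ.+ 0) ∷ []
blockEquations c (sum i j _ _)  = sumEquations i j c

data Program : ℕ → ℕ → Set where
  done : ∀ {c} → Program c c
  step : ∀ {c d} (b : Block c) → Program (c ℕ.+ size b) d → Program c d

infixr 5 _⨟_

_⨟_ : ∀ {a c d} → Program a c → Program c d → Program a d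
done     ⨟ Q = Q
step b P ⨟ Q = step b (P ⨟ Q)

start≤end : ∀ {c d} → Program c d → c ≤ d
start≤end done       = ≤-refl
start≤end (step b P) = ≤-trans (m≤m+n _ _) (start≤end P)

weaken : ∀ {c d k} → Program c d → k < c → k < d
weaken P k<c = <-≤-trans k<c (start≤end P)

equations : ∀ {c d} → Program c d → List Equationℕ
equations done           = []
equations (step {c} b P) = blockEquations c b ++ equations P

-- Intended values: running a program in any structure with 1, + and ·

module Semantics {a} {A : Set a} (1# : A) (_+_ _*_ : A → A → A) where

  ⟦_⟧ : Expr → A → A → A → A
  ⟦ X ⟧     x y z = x
  ⟦ Y ⟧     x y z = y
  ⟦ Z ⟧     x y z = z
  ⟦ one ⟧   x y z = 1#
  ⟦ e ⊕ f ⟧ x y z = ⟦ e ⟧ x y z + ⟦ f ⟧ x y z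
  ⟦ e ⊗ f ⟧ x y z = ⟦ e ⟧ x y z * ⟦ f ⟧ x y z

  blockValue : ∀ {c} → Block c → (ℕ → A) → ℕ → A
  blockValue b f r = ⟦ blockExpr b r ⟧ x y (x + y)
    where
    x = f (operandˡ b)
    y = f (operandʳ b)

  extend : (ℕ → A) → ℕ → (ℕ → A) → ℕ → A
  extend f c g k with k <? c
  ... | yes _ = f k
  ... | no  _ = g (k ∸ c)

  extend-< : ∀ f c g {k} → k < c → extend f c g k ≡ f k
  extend-< f c g {k} k<c with k <? c
  ... | yes _   = ≡.refl
  ... | no  k≮c = contradiction k<c k≮c

  extend-+ : ∀ f c g r → extend f c g (c ℕ.+ r) ≡ g r
  extend-+ f c g r with c ℕ.+ r <? c
  ... | yes c+r<c = contradiction c+r<c (m+n≮m c r)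
  ... | no  _     = cong g (m+n∸m≡n c r)

  run : ∀ {c d} → Program c d → (ℕ → A) → ℕ → A
  run done           f = f
  run (step {c} b P) f = run P (extend f c (blockValue b f))

  run-below : ∀ {c d} (P : Program c d) f {k} → k < c → run P f k ≡ f k
  run-below done           f k<c = ≡.refl
  run-below (step {c} b P) f k<c =
    ≡.trans (run-below P _ (<-≤-trans k<c (m≤m+n c (size b)))) (extend-< f c _ k<c)

  run-block : ∀ {c d} (b : Block c) (P : Program (c ℕ.+ size b) d) f {r} → r < size b →
              run (step b P) f (c ℕ.+ r) ≡ blockValue b f r
  run-block {c} b P f {r} r<size =
    ≡.trans (run-below P _ (+-monoʳ-< c r<size)) (extend-+ f c (blockValue b f) r)

  module Closure {q} (Q : A → Set q) (Q-1 : Q 1#)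
                 (Q-+ : ∀ {u v} → Q u → Q v → Q (u + v))
                 (Q-* : ∀ {u v} → Q u → Q v → Q (u * v)) where

    ⟦⟧-closed : ∀ e {x y z} → Q x → Q y → Q z → Q (⟦ e ⟧ x y z)
    ⟦⟧-closed X       qx qy qz = qx
    ⟦⟧-closed Y       qx qy qz = qy
    ⟦⟧-closed Z       qx qy qz = qz
    ⟦⟧-closed one     qx qy qz = Q-1
    ⟦⟧-closed (e ⊕ f) qx qy qz = Q-+ (⟦⟧-closed e qx qy qz) (⟦⟧-closed f qx qy qz)
    ⟦⟧-closed (e ⊗ f) qx qy qz = Q-* (⟦⟧-closed e qx qy qz) (⟦⟧-closed f qx qy qz)

    extend-closed : ∀ f c g → (∀ k → Q (f k)) → (∀ r → Q (g r)) → ∀ k → Q (extend f c g k)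
    extend-closed f c g qf qg k with k <? c
    ... | yes _ = qf k
    ... | no  _ = qg (k ∸ c)

    run-closed : ∀ {c d} (P : Program c d) f → (∀ k → Q (f k)) → ∀ k → Q (run P f k)
    run-closed done           f qf = qf
    run-closed (step {c} b P) f qf = run-closed P _ (extend-closed f c _ qf qb)
      where
      qb : ∀ r → Q (blockValue b f r)
      qb r = ⟦⟧-closed (blockExpr b r) (qf _) (qf _) (Q-+ (qf _) (qf _))

-- In a commutative ring the equations of a block force its intended values

module RingSemantics {c ℓ} (R : CommutativeRing c ℓ) where
  open CommutativeRing R
  open Semantics 1# _+_ _*_ public
  open import Relation.Binary.Reasoning.Setoid setoid
  open import Algebra.Properties.Group +-group
    using () renaming (∙-cancelˡ to +-cancelˡ; ∙-cancelʳ to +-cancelʳ)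
  open import Algebra.Solver.Ring.NaturalCoefficients.Default commutativeSemiring
    using (solve; _:+_; _:*_; con; _:=_)

  Holds : (ℕ → Carrier) → Equationℕ → Set ℓ
  Holds y (addOneℕ i k) = y i + 1# ≈ y k
  Holds y (mulℕ i j k)  = y i * y j ≈ y k

  Satisfies : (ℕ → Carrier) → ∀ {c d} → Program c d → Set ℓ
  Satisfies y P = All (Holds y) (equations P)

  satisfies-⨟ : ∀ {a c d} y (P : Program a c) (Q : Program c d) →
                Satisfies y (P ⨟ Q) → Satisfies y P × Satisfies y Q
  satisfies-⨟ y done           Q sat = [] , sat
  satisfies-⨟ y (step {c} b P) Q sat with All.++⁻ (blockEquations c b) sat
  ... | satb , satPQ with satisfies-⨟ y P Q satPQ
  ...   | satP , satQ = All.++⁺ satb satP , satQ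

  Intended : (ℕ → Carrier) → ∀ {c} → Block c → Set ℓ
  Intended y {c} b = ∀ r → r < size b → y (c ℕ.+ r) ≈ blockValue b y r

  ⟦⟧-cong : ∀ e {x x′ y y′ z z′} → x ≈ x′ → y ≈ y′ → z ≈ z′ → ⟦ e ⟧ x y z ≈ ⟦ e ⟧ x′ y′ z′
  ⟦⟧-cong X       px py pz = px
  ⟦⟧-cong Y       px py pz = py
  ⟦⟧-cong Z       px py pz = pz
  ⟦⟧-cong one     px py pz = refl
  ⟦⟧-cong (e ⊕ f) px py pz = +-cong (⟦⟧-cong e px py pz) (⟦⟧-cong f px py pz)
  ⟦⟧-cong (e ⊗ f) px py pz = *-cong (⟦⟧-cong e px py pz) (⟦⟧-cong f px py pz)

  blockValue-cong : ∀ {c} (b : Block c) {y y′} → (∀ k → k < c → y k ≈ y′ k) →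
                    ∀ r → blockValue b y r ≈ blockValue b y′ r
  blockValue-cong unit               y≈y′ zero    = refl
  blockValue-cong unit               y≈y′ (suc r) = refl
  blockValue-cong (prod i j i<c j<c) y≈y′ r =
    ⟦⟧-cong (X ⊗ Y) (y≈y′ i i<c) (y≈y′ j j<c) (+-cong (y≈y′ i i<c) (y≈y′ j j<c))
  blockValue-cong (sum i j i<c j<c)  y≈y′ r =
    ⟦⟧-cong (sumVar r) (y≈y′ i i<c) (y≈y′ j j<c) (+-cong (y≈y′ i i<c) (y≈y′ j j<c))

  unitChecks⇒ : ∀ {o t} → o * o ≈ o → o + 1# ≈ t → o * t ≈ t → o ≈ 1#
  unitChecks⇒ {o} {t} o²≈o o+1≈t ot≈t = +-cancelˡ o o 1# (begin
    o + o          ≈⟨ +-cong (sym o²≈o) (sym (*-identityʳ o)) ⟩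
    o * o + o * 1# ≈⟨ sym (distribˡ o o 1#) ⟩
    o * (o + 1#)   ≈⟨ *-cong refl o+1≈t ⟩
    o * t          ≈⟨ ot≈t ⟩
    t              ≈⟨ sym o+1≈t ⟩
    o + 1#         ∎)

  SumCheck : Carrier → Carrier → Carrier → Set ℓ
  SumCheck x y z = z * z * (x * y + 1#) + 1# ≈ (x * z + 1#) * (y * z + 1#)

  sumCheck-holds : ∀ {x y z} → z ≈ x + y → SumCheck x y z
  sumCheck-holds {x} {y} {z} z≈x+y = begin
    z * z * (x * y + 1#) + 1#                ≈⟨ +-cong (⟦⟧-cong (sumVar 9) refl refl z≈x+y) refl ⟩
    (x + y) * (x + y) * (x * y + 1#) + 1#    ≈⟨ expand x y ⟩
    (x * (x + y) + 1#) * (y * (x + y) + 1#)  ≈⟨ ⟦⟧-cong (sumVar 5) refl refl (sym z≈x+y) ⟩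
    (x * z + 1#) * (y * z + 1#)              ∎
    where
    expand : ∀ x y → (x + y) * (x + y) * (x * y + 1#) + 1# ≈ (x * (x + y) + 1#) * (y * (x + y) + 1#)
    expand = solve 2 (λ x y → (x :+ y) :* (x :+ y) :* (x :* y :+ con 1) :+ con 1
                            := (x :* (x :+ y) :+ con 1) :* (y :* (x :+ y) :+ con 1)) refl

  sumCheck⇒ : ∀ {x y z} → SumCheck x y z → z * z ≈ z * (x + y)
  sumCheck⇒ {x} {y} {z} check = +-cancelʳ 1# _ _ (+-cancelˡ (x * y * (z * z)) _ _ (begin
    x * y * (z * z) + (z * z + 1#)        ≈⟨ lhs x y z ⟩
    z * z * (x * y + 1#) + 1#             ≈⟨ check ⟩
    (x * z + 1#) * (y * z + 1#)           ≈⟨ rhs x y z ⟩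
    x * y * (z * z) + (z * (x + y) + 1#)  ∎))
    where
    lhs : ∀ x y z → x * y * (z * z) + (z * z + 1#) ≈ z * z * (x * y + 1#) + 1#
    lhs = solve 3 (λ x y z → x :* y :* (z :* z) :+ (z :* z :+ con 1)
                          := z :* z :* (x :* y :+ con 1) :+ con 1) refl
    rhs : ∀ x y z → (x * z + 1#) * (y * z + 1#) ≈ x * y * (z * z) + (z * (x + y) + 1#)
    rhs = solve 3 (λ x y z → (x :* z :+ con 1) :* (y :* z :+ con 1)
                          := x :* y :* (z :* z) :+ (z :* (x :+ y) :+ con 1)) refl

  sumChecks⇒ : ∀ {x y z} → SumCheck x y z → SumCheck (x + 1#) y (z + 1#) → z ≈ x + y
  sumChecks⇒ {x} {y} {z} check check′ =
    +-cancelˡ z _ _ (+-cancelˡ (z * z) _ _ (+-cancelʳ 1# _ _ (begin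
      z * z + (z + z) + 1#               ≈⟨ square z ⟩
      (z + 1#) * (z + 1#)                ≈⟨ sumCheck⇒ check′ ⟩
      (z + 1#) * (x + 1# + y)            ≈⟨ expand x y z ⟩
      z * (x + y) + (z + (x + y)) + 1#   ≈⟨ +-cong (+-cong (sym (sumCheck⇒ check)) refl) refl ⟩
      z * z + (z + (x + y)) + 1#         ∎)))
    where
    square : ∀ z → z * z + (z + z) + 1# ≈ (z + 1#) * (z + 1#)
    square = solve 1 (λ z → z :* z :+ (z :+ z) :+ con 1 := (z :+ con 1) :* (z :+ con 1)) refl
    expand : ∀ x y z → (z + 1#) * (x + 1# + y) ≈ z * (x + y) + (z + (x + y)) + 1#
    expand = solve 3 (λ x y z → (z :+ con 1) :* (x :+ con 1 :+ y)
                             := z :* (x :+ y) :+ (z :+ (x :+ y)) :+ con 1) refl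

  sumEquations⇒intended : ∀ {c} i j y → All (Holds y) (sumEquations i j c) →
                          ∀ r → r < 21 → y (c ℕ.+ r) ≈ ⟦ sumVar r ⟧ (y i) (y j) (y i + y j)
  sumEquations⇒intended {c} i j y
    (e₁ ∷ e₂ ∷ e₃ ∷ e₄ ∷ e₅ ∷ e₆ ∷ e₇ ∷ e₈ ∷ e₉ ∷ e₁₀ ∷
     e₁₁ ∷ e₁₂ ∷ e₁₃ ∷ e₁₄ ∷ e₁₅ ∷ e₁₆ ∷ e₁₇ ∷ e₁₈ ∷ e₁₉ ∷ e₂₀ ∷ check ∷ check′ ∷ []) r r<21 =
    trans (trace r {<⇒<ᵇ r<21}) (⟦⟧-cong (sumVar r) refl refl z≈x+y)
    where
    z = y (c ℕ.+ 0)
    trace : ∀ r → {T (r <ᵇ 21)} → y (c ℕ.+ r) ≈ ⟦ sumVar r ⟧ (y i) (y j) z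
    trace 0  = refl
    trace 1  = trans (sym e₁)  (*-cong refl (trace 0))
    trace 2  = trans (sym e₂)  (+-cong (trace 1) refl)
    trace 3  = trans (sym e₃)  (*-cong refl (trace 0))
    trace 4  = trans (sym e₄)  (+-cong (trace 3) refl)
    trace 5  = trans (sym e₅)  (*-cong (trace 2) (trace 4))
    trace 6  = trans (sym e₆)  (*-cong (trace 0) (trace 0))
    trace 7  = sym e₇
    trace 8  = trans (sym e₈)  (+-cong (trace 7) refl)
    trace 9  = trans (sym e₉)  (*-cong (trace 6) (trace 8))
    trace 10 = trans (sym e₁₀) (+-cong (trace 0) refl)
    trace 11 = sym e₁₁
    trace 12 = trans (sym e₁₂) (*-cong (trace 11) (trace 10))
    trace 13 = trans (sym e₁₃) (+-cong (trace 12) refl)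
    trace 14 = trans (sym e₁₄) (*-cong refl (trace 10))
    trace 15 = trans (sym e₁₅) (+-cong (trace 14) refl)
    trace 16 = trans (sym e₁₆) (*-cong (trace 13) (trace 15))
    trace 17 = trans (sym e₁₇) (*-cong (trace 10) (trace 10))
    trace 18 = trans (sym e₁₈) (*-cong (trace 11) refl)
    trace 19 = trans (sym e₁₉) (+-cong (trace 18) refl)
    trace 20 = trans (sym e₂₀) (*-cong (trace 17) (trace 19))
    trace (suc (suc (suc (suc (suc (suc (suc (suc (suc (suc
          (suc (suc (suc (suc (suc (suc (suc (suc (suc (suc (suc _))))))))))))))))))))) {()}
    z≈x+y : z ≈ y i + y j
    z≈x+y = sumChecks⇒ (trans (+-cong (sym (trace 9)) refl) (trans check (trace 5)))
                       (trans (+-cong (sym (trace 20)) refl) (trans check′ (trace 16)))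

  intended⇒sumEquations : ∀ {c} i j y →
                          (∀ r → r < 21 → y (c ℕ.+ r) ≈ ⟦ sumVar r ⟧ (y i) (y j) (y i + y j)) →
                          All (Holds y) (sumEquations i j c)
  intended⇒sumEquations {c} i j y intended =
    trans (*-cong refl (v 0)) (sym (v 1)) ∷ trans (+-cong (v 1) refl) (sym (v 2)) ∷
    trans (*-cong refl (v 0)) (sym (v 3)) ∷ trans (+-cong (v 3) refl) (sym (v 4)) ∷
    trans (*-cong (v 2) (v 4)) (sym (v 5)) ∷ trans (*-cong (v 0) (v 0)) (sym (v 6)) ∷
    sym (v 7) ∷ trans (+-cong (v 7) refl) (sym (v 8)) ∷
    trans (*-cong (v 6) (v 8)) (sym (v 9)) ∷ trans (+-cong (v 0) refl) (sym (v 10)) ∷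
    sym (v 11) ∷ trans (*-cong (v 11) (v 10)) (sym (v 12)) ∷
    trans (+-cong (v 12) refl) (sym (v 13)) ∷ trans (*-cong refl (v 10)) (sym (v 14)) ∷
    trans (+-cong (v 14) refl) (sym (v 15)) ∷ trans (*-cong (v 13) (v 15)) (sym (v 16)) ∷
    trans (*-cong (v 10) (v 10)) (sym (v 17)) ∷ trans (*-cong (v 11) refl) (sym (v 18)) ∷
    trans (+-cong (v 18) refl) (sym (v 19)) ∷ trans (*-cong (v 17) (v 19)) (sym (v 20)) ∷
    trans (+-cong (v 9) refl) (trans (sumCheck-holds refl) (sym (v 5))) ∷
    trans (+-cong (v 20) refl) (trans (sumCheck-holds x+y+1≈x+1+y) (sym (v 16))) ∷ []
    where
    v : ∀ r → {T (r <ᵇ 21)} → y (c ℕ.+ r) ≈ ⟦ sumVar r ⟧ (y i) (y j) (y i + y j)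
    v r {r<21} = intended r (<ᵇ⇒< r 21 r<21)
    x+y+1≈x+1+y : y i + y j + 1# ≈ y i + 1# + y j
    x+y+1≈x+1+y = trans (+-assoc _ _ _) (trans (+-cong refl (+-comm _ _)) (sym (+-assoc _ _ _)))

  blockEquations⇒intended : ∀ c (b : Block c) y → All (Holds y) (blockEquations c b) → Intended y b
  blockEquations⇒intended c unit y (o²≈o ∷ o+1≈t ∷ ot≈t ∷ []) = intended
    where
    o≈1 = unitChecks⇒ o²≈o o+1≈t ot≈t
    intended : Intended y {c} unit
    intended 0 _ = o≈1
    intended 1 _ = trans (sym o+1≈t) (+-cong o≈1 refl)
    intended (suc (suc r)) (s≤s (s≤s ()))
  blockEquations⇒intended c (prod i j _ _) y (e ∷ []) 0 _ = sym e
  blockEquations⇒intended c (prod i j _ _) y (e ∷ []) (suc r) (s≤s ())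
  blockEquations⇒intended c (sum i j _ _) y eqs = sumEquations⇒intended i j y eqs

  intended⇒blockEquations : ∀ c (b : Block c) y → Intended y b → All (Holds y) (blockEquations c b)
  intended⇒blockEquations c unit y intended =
    trans (*-cong o≈1 o≈1) (trans (*-identityˡ 1#) (sym o≈1)) ∷
    trans (+-cong o≈1 refl) (sym (intended 1 (s≤s (s≤s z≤n)))) ∷
    trans (*-cong o≈1 refl) (*-identityˡ _) ∷ []
    where
    o≈1 = intended 0 (s≤s z≤n)
  intended⇒blockEquations c (prod i j _ _) y intended = sym (intended 0 (s≤s z≤n)) ∷ []
  intended⇒blockEquations c (sum i j _ _)  y intended = intended⇒sumEquations i j y intended

  satisfies-unique : ∀ {c d} (P : Program c d) {y y′} → Satisfies y P → Satisfies y′ P →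
                     (∀ k → k < c → y k ≈ y′ k) → ∀ k → k < d → y k ≈ y′ k
  satisfies-unique done                   sat sat′ y≈y′ = y≈y′
  satisfies-unique (step {c} b P) {y} {y′} sat sat′ y≈y′ =
    satisfies-unique P (All.++⁻ʳ (blockEquations c b) sat) (All.++⁻ʳ (blockEquations c b) sat′) y≈y′+
    where
    intended  = blockEquations⇒intended c b y  (All.++⁻ˡ (blockEquations c b) sat)
    intended′ = blockEquations⇒intended c b y′ (All.++⁻ˡ (blockEquations c b) sat′)
    y≈y′+ : ∀ k → k < c ℕ.+ size b → y k ≈ y′ k
    y≈y′+ k k<c+s with k <? c
    ... | yes k<c = y≈y′ k k<c
    ... | no  k≮c = ≡.subst (λ k → y k ≈ y′ k) c+r≡k
                      (trans (intended r r<s) (trans (blockValue-cong b y≈y′ r) (sym (intended′ r r<s))))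
      where
      r = k ∸ c
      c+r≡k : c ℕ.+ r ≡ k
      c+r≡k = m+[n∸m]≡n (≮⇒≥ k≮c)
      r<s : r < size b
      r<s = +-cancelˡ-< c r (size b) (≡.subst (_< c ℕ.+ size b) (≡.sym c+r≡k) k<c+s)

  run-satisfies : ∀ {c d} (P : Program c d) f {y} → (∀ k → k < d → y k ≈ run P f k) → Satisfies y P
  run-satisfies done           f y≈run = []
  run-satisfies (step {c} b P) f {y} y≈run =
    All.++⁺ (intended⇒blockEquations c b y intended) (run-satisfies P _ y≈run)
    where
    f≈y : ∀ k → k < c → f k ≈ y k
    f≈y k k<c = sym (trans (y≈run k (weaken (step b P) k<c)) (reflexive (run-below (step b P) f k<c)))
    intended : Intended y b
    intended r r<s = begin
      y (c ℕ.+ r)                 ≈⟨ y≈run (c ℕ.+ r) (weaken P (+-monoʳ-< c r<s)) ⟩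
      run (step b P) f (c ℕ.+ r)  ≡⟨ run-block b P f r<s ⟩
      blockValue b f r            ≈⟨ blockValue-cong b f≈y r ⟩
      blockValue b y r            ∎

-- Compiling a polynomial

record Compiled (c : ℕ) : Set where
  constructor compiled
  field
    {end}   : ℕ
    code    : Program c end
    out     : ℕ
    out<end : out < end
open Compiled

record Compiled₂ (c : ℕ) : Set where
  constructor compiled₂
  field
    {end₂}   : ℕ
    code₂    : Program c end₂
    outᵖ     : ℕ
    outⁿ     : ℕ
    outᵖ<end : outᵖ < end₂
    outⁿ<end : outⁿ < end₂
open Compiled₂

infixr 5 _▷_ _▷₂_

_▷_ : ∀ {c d} → Program c d → Compiled d → Compiled c
P ▷ C = compiled (P ⨟ code C) (out C) (out<end C)

_▷₂_ : ∀ {c d} → Program c d → Compiled₂ d → Compiled₂ c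
P ▷₂ C = compiled₂ (P ⨟ code₂ C) (outᵖ C) (outⁿ C) (outᵖ<end C) (outⁿ<end C)

prodC : ∀ c i j → i < c → j < c → Compiled c
prodC c i j i<c j<c = compiled (step (prod i j i<c j<c) done) (c ℕ.+ 0) (+-monoʳ-< c (s≤s z≤n))

sumC : ∀ c i j → i < c → j < c → Compiled c
sumC c i j i<c j<c = compiled (step (sum i j i<c j<c) done) (c ℕ.+ 0) (+-monoʳ-< c (s≤s z≤n))

-- The argument o of powC, monomialC, termC and termsC is a variable holding 1.
powC : ∀ c x o → x < c → o < c → ℕ → Compiled c
powC c x o x<c o<c zero    = compiled done o o<c
powC c x o x<c o<c (suc e) = code C ▷ prodC (end C) x (out C) (weaken (code C) x<c) (out<end C)
  where
  C = powC c x o x<c o<c e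

monomialC : ∀ q → Vec ℕ q → ∀ c (var : Fin q → ℕ) → (∀ i → var i < c) →
            ∀ o → o < c → Compiled c
monomialC zero    es c var var<c o o<c = compiled done o o<c
monomialC (suc q) es c var var<c o o<c =
  code C ▷ code D ▷ prodC (end D) (out D) (out C) (out<end D) (weaken (code D) (out<end C))
  where
  C = monomialC q (tail es) c (var ∘ Fin.suc) (var<c ∘ Fin.suc) o o<c
  D = powC (end C) (var Fin.zero) o (weaken (code C) (var<c Fin.zero)) (weaken (code C) o<c) (lookup es Fin.zero)

scaleAddC : ℕ → ∀ c acc m → acc < c → m < c → Compiled c
scaleAddC zero    c acc m acc<c m<c = compiled done acc acc<c
scaleAddC (suc n) c acc m acc<c m<c = code C ▷ sumC (end C) (out C) m (out<end C) (weaken (code C) m<c)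
  where
  C = scaleAddC n c acc m acc<c m<c

coeffC : ℤ → ∀ c P N m → P < c → N < c → m < c → Compiled₂ c
coeffC (+ a)     c P N m P<c N<c m<c = compiled₂ (code C) (out C) N (out<end C) (weaken (code C) N<c)
  where
  C = scaleAddC a c P m P<c m<c
coeffC -[1+ a ] c P N m P<c N<c m<c = compiled₂ (code C) P (out C) (weaken (code C) P<c) (out<end C)
  where
  C = scaleAddC (suc a) c N m N<c m<c

termC : ∀ {p} → Monomial p → ∀ c → p ≤ c → ∀ o P N → o < c → P < c → N < c → Compiled₂ c
termC {p} m c p≤c o P N o<c P<c N<c =
  code C ▷₂ coeffC (coeff m) (end C) P N (out C) (weaken (code C) P<c) (weaken (code C) N<c) (out<end C)
  where
  C = monomialC p (exps m) c toℕ (λ i → <-≤-trans (toℕ<n i) p≤c) o o<c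

termsC : ∀ {p} → List (Monomial p) → ∀ c → p ≤ c →
         ∀ o P N → o < c → P < c → N < c → Compiled₂ c
termsC []       c p≤c o P N o<c P<c N<c = compiled₂ done P N P<c N<c
termsC (m ∷ ms) c p≤c o P N o<c P<c N<c =
  code₂ C ▷₂ termsC ms (end₂ C) (≤-trans p≤c (start≤end (code₂ C))) o (outᵖ C) (outⁿ C)
                    (weaken (code₂ C) o<c) (outᵖ<end C) (outⁿ<end C)
  where
  C = termC m c p≤c o P N o<c P<c N<c

-- Variables 0,…,p−1 hold x₁,…,x_p; the unit block puts 1 into variable p,
-- which is also the start value of both accumulators.
unitVar : ℕ → ℕ
unitVar p = p ℕ.+ 0

unitVar< : ∀ p → unitVar p < p ℕ.+ 2
unitVar< p = +-monoʳ-< p (s≤s z≤n)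

termsOf : ∀ {p} → Poly p → Compiled₂ (p ℕ.+ 2)
termsOf {p} D =
  termsC (monos D) (p ℕ.+ 2) (m≤m+n p 2)
         (unitVar p) (unitVar p) (unitVar p) (unitVar< p) (unitVar< p) (unitVar< p)

polyC : ∀ {p} → Poly p → Compiled₂ p
polyC D = step unit done ▷₂ termsOf D

program : ∀ {p} (D : Poly p) → Program p (end₂ (polyC D))
program D = code₂ (polyC D)

finalEquation : ∀ {p} → Poly p → Equationℕ
finalEquation {p} D = mulℕ (outᵖ (polyC D)) (unitVar p) (outⁿ (polyC D))

systemℕ : ∀ {p} → Poly p → List Equationℕ
systemℕ D = equations (program D) ++ finalEquation D ∷ []

nVars : ∀ {p} → Poly p → ℕ
nVars D = end₂ (polyC D)

p<nVars : ∀ {p} (D : Poly p) → p < nVars D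
p<nVars {p} D = <-≤-trans (m<m+n p (s≤s z≤n)) (start≤end (code₂ (termsOf D)))

embedding : ∀ {p} (D : Poly p) → Fin p → Fin (nVars D)
embedding D i = inject≤ i (<⇒≤ (p<nVars D))

-- The indices of systemℕ are all below nVars, so the default is never used.
clamp : ∀ {n} → Fin n → ℕ → Fin n
clamp {n} default k with k <? n
... | yes k<n = fromℕ< k<n
... | no  _   = default

toℕ-clamp : ∀ {n} (default : Fin n) {k} → k < n → toℕ (clamp default k) ≡ k
toℕ-clamp {n} default {k} k<n with k <? n
... | yes _   = toℕ-fromℕ< k<n
... | no  k≮n = contradiction k<n k≮n

clamp-toℕ : ∀ {n} (default j : Fin n) → clamp default (toℕ j) ≡ j
clamp-toℕ default j = toℕ-injective (toℕ-clamp default (toℕ<n j))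

toEquation : ∀ {n} → (ℕ → Fin n) → Equationℕ → Equation n
toEquation var (addOneℕ i k) = addOne (var i) (var k)
toEquation var (mulℕ i j k)  = mul (var i) (var j) (var k)

varOf : ∀ {p} (D : Poly p) → ℕ → Fin (nVars D)
varOf D = clamp (fromℕ< (p<nVars D))

varOf-toℕ : ∀ {p} (D : Poly p) (i : Fin p) → varOf D (toℕ i) ≡ embedding D i
varOf-toℕ D i = toℕ-injective (≡.trans (toℕ-clamp _ (<-trans (toℕ<n i) (p<nVars D)))
                                         (≡.sym (toℕ-inject≤ i (<⇒≤ (p<nVars D)))))

system : ∀ {p} (D : Poly p) → System (nVars D)
system D = map (toEquation (varOf D)) (systemℕ D)

padded : ∀ {a} {A : Set a} {p} → (Fin p → A) → A → ℕ → A
padded {p = zero}  x d k       = d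
padded {p = suc p} x d zero    = x Fin.zero
padded {p = suc p} x d (suc k) = padded (x ∘ Fin.suc) d k

padded-toℕ : ∀ {a} {A : Set a} {p} (x : Fin p → A) d i → padded x d (toℕ i) ≡ x i
padded-toℕ x d Fin.zero    = ≡.refl
padded-toℕ x d (Fin.suc i) = padded-toℕ (x ∘ Fin.suc) d i

padded-closed : ∀ {a q} {A : Set a} (Q : A → Set q) {p} (x : Fin p → A) {d} →
                (∀ i → Q (x i)) → Q d → ∀ k → Q (padded x d k)
padded-closed Q {zero}  x qx qd k       = qd
padded-closed Q {suc p} x qx qd zero    = qx Fin.zero
padded-closed Q {suc p} x qx qd (suc k) = padded-closed Q (x ∘ Fin.suc) (qx ∘ Fin.suc) qd k

-- Correctness over a commutative ring

-- D is evaluated with any coefficient map ι agreeing with intR R; for ℤ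
-- with ι = id this is literally the evaluation used for ℕ in Lemma4Conclusion.
module RingCorrectness {c ℓ} (R : CommutativeRing c ℓ) (ι : ℤ → CommutativeRing.Carrier R)
                       (ι≈intR : ∀ z → CommutativeRing._≈_ R (ι z) (intR R z)) where
  open CommutativeRing R
  open RingSemantics R
  open Eval 0# 1# _+_ _*_ ι
  module S = Solves _≈_ 1# _+_ _*_
  open import Relation.Binary.Reasoning.Setoid setoid
  open import Algebra.Properties.Group +-group
    using () renaming (∙-cancelˡ to +-cancelˡ; ∙-cancelʳ to +-cancelʳ)
  open import Algebra.Solver.Ring.NaturalCoefficients.Default commutativeSemiring
    using (solve; _:+_; _:*_; con; _:=_)

  Computes : (ℕ → Carrier) → ∀ {c} → Compiled c → Carrier → Set ℓ
  Computes y C v = Satisfies y (code C) → y (out C) ≈ v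

  Computes₂ : (ℕ → Carrier) → ∀ {c} → Compiled₂ c → Carrier → Carrier → Set ℓ
  Computes₂ y C v w = Satisfies y (code₂ C) → y (outᵖ C) ≈ v × y (outⁿ C) ≈ w

  prodC-computes : ∀ {c i j} i<c j<c y → Computes y (prodC c i j i<c j<c) (y i * y j)
  prodC-computes i<c j<c y (e ∷ []) = sym e

  sumC-computes : ∀ {c i j} i<c j<c y → Computes y (sumC c i j i<c j<c) (y i + y j)
  sumC-computes {c} {i} {j} i<c j<c y sat = blockEquations⇒intended c (sum i j i<c j<c) y sat 0 (s≤s z≤n)

  powC-computes : ∀ {c x o} x<c o<c y → y o ≈ 1# → ∀ e → Computes y (powC c x o x<c o<c e) (pow (y x) e)
  powC-computes x<c o<c y o≈1 zero sat = o≈1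
  powC-computes {c} {x} {o} x<c o<c y o≈1 (suc e) sat =
    trans (prodC-computes (weaken (code C) x<c) (out<end C) y (proj₂ split))
          (*-cong refl (powC-computes x<c o<c y o≈1 e (proj₁ split)))
    where
    C = powC c x o x<c o<c e
    split = satisfies-⨟ y (code C) _ sat

  monomialC-computes : ∀ q es c var var<c o o<c y → y o ≈ 1# →
                       Computes y (monomialC q es c var var<c o o<c) (monoProd es (y ∘ var))
  monomialC-computes zero    es c var var<c o o<c y o≈1 sat = o≈1
  monomialC-computes (suc q) es c var var<c o o<c y o≈1 sat =
    trans (prodC-computes (out<end D) (weaken (code D) (out<end C)) y (proj₂ splitD))
          (*-cong (powC-computes (weaken (code C) (var<c Fin.zero)) (weaken (code C) o<c) y o≈1
                                 (lookup es Fin.zero) (proj₁ splitD))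
                  (monomialC-computes q (tail es) c (var ∘ Fin.suc) (var<c ∘ Fin.suc) o o<c y o≈1
                                      (proj₁ splitC)))
    where
    C = monomialC q (tail es) c (var ∘ Fin.suc) (var<c ∘ Fin.suc) o o<c
    D = powC (end C) (var Fin.zero) o (weaken (code C) (var<c Fin.zero)) (weaken (code C) o<c) (lookup es Fin.zero)
    splitC = satisfies-⨟ y (code C) _ sat
    splitD = satisfies-⨟ y (code D) _ (proj₂ splitC)

  x≈x+0*y : ∀ a m → a ≈ a + 0# * m
  x≈x+0*y a m = sym (trans (+-cong refl (zeroˡ m)) (+-identityʳ a))

  scaleAddC-computes : ∀ n c acc m acc<c m<c y →
                       Computes y (scaleAddC n c acc m acc<c m<c) (y acc + natR R n * y m)
  scaleAddC-computes zero    c acc m acc<c m<c y sat = x≈x+0*y (y acc) (y m)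
  scaleAddC-computes (suc n) c acc m acc<c m<c y sat =
    trans (sumC-computes (out<end C) (weaken (code C) m<c) y (proj₂ split))
          (trans (+-cong (scaleAddC-computes n c acc m acc<c m<c y (proj₁ split)) refl)
                 (addOnce (y acc) (natR R n) (y m)))
    where
    C = scaleAddC n c acc m acc<c m<c
    split = satisfies-⨟ y (code C) _ sat
    addOnce : ∀ a k m → a + k * m + m ≈ a + (1# + k) * m
    addOnce = solve 3 (λ a k m → a :+ k :* m :+ m := a :+ (con 1 :+ k) :* m) refl

  posPart negPart : ℤ → Carrier
  posPart (+ a)     = natR R a
  posPart -[1+ _ ]  = 0#
  negPart (+ _)     = 0#
  negPart -[1+ a ]  = natR R (suc a)

  coeffC-computes : ∀ a c P N m P<c N<c m<c y →
                    Computes₂ y (coeffC a c P N m P<c N<c m<c) (y P + posPart a * y m) (y N + negPart a * y m)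
  coeffC-computes (+ a)    c P N m P<c N<c m<c y sat =
    scaleAddC-computes a c P m P<c m<c y sat , x≈x+0*y (y N) (y m)
  coeffC-computes -[1+ a ] c P N m P<c N<c m<c y sat =
    x≈x+0*y (y P) (y m) , scaleAddC-computes (suc a) c N m N<c m<c y sat

  weightedSum : ∀ {p} → (ℤ → Carrier) → List (Monomial p) → (Fin p → Carrier) → Carrier
  weightedSum w []       x = 0#
  weightedSum w (m ∷ ms) x = w (coeff m) * monoProd (exps m) x + weightedSum w ms x

  termC-computes : ∀ {p} m c p≤c o P N o<c P<c N<c y → y o ≈ 1# →
                   Computes₂ y (termC {p} m c p≤c o P N o<c P<c N<c)
                             (y P + posPart (coeff m) * monoProd (exps m) (y ∘ toℕ))
                             (y N + negPart (coeff m) * monoProd (exps m) (y ∘ toℕ))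
  termC-computes {p} m c p≤c o P N o<c P<c N<c y o≈1 sat =
    trans (proj₁ coefficient) (+-cong refl (*-cong refl monomial)) ,
    trans (proj₂ coefficient) (+-cong refl (*-cong refl monomial))
    where
    M = monomialC p (exps m) c toℕ (λ i → <-≤-trans (toℕ<n i) p≤c) o o<c
    split = satisfies-⨟ y (code M) _ sat
    monomial = monomialC-computes p (exps m) c toℕ (λ i → <-≤-trans (toℕ<n i) p≤c) o o<c y o≈1
                                  (proj₁ split)
    coefficient = coeffC-computes (coeff m) (end M) P N (out M) (weaken (code M) P<c) (weaken (code M) N<c)
                                  (out<end M) y (proj₂ split)

  termsC-computes : ∀ {p} ms c p≤c o P N o<c P<c N<c y → y o ≈ 1# →
                    Computes₂ y (termsC {p} ms c p≤c o P N o<c P<c N<c)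
                              (y P + weightedSum posPart ms (y ∘ toℕ))
                              (y N + weightedSum negPart ms (y ∘ toℕ))
  termsC-computes []       c p≤c o P N o<c P<c N<c y o≈1 sat = sym (+-identityʳ _) , sym (+-identityʳ _)
  termsC-computes (m ∷ ms) c p≤c o P N o<c P<c N<c y o≈1 sat =
    trans (proj₁ rest) (trans (+-cong (proj₁ first) refl) (+-assoc _ _ _)) ,
    trans (proj₂ rest) (trans (+-cong (proj₂ first) refl) (+-assoc _ _ _))
    where
    C = termC m c p≤c o P N o<c P<c N<c
    split = satisfies-⨟ y (code₂ C) _ sat
    first = termC-computes m c p≤c o P N o<c P<c N<c y o≈1 (proj₁ split)
    rest = termsC-computes ms (end₂ C) (≤-trans p≤c (start≤end (code₂ C))) o (outᵖ C) (outⁿ C)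
                           (weaken (code₂ C) o<c) (outᵖ<end C) (outⁿ<end C) y o≈1 (proj₂ split)

  pow-cong : ∀ {a b} e → a ≈ b → pow a e ≈ pow b e
  pow-cong zero    a≈b = refl
  pow-cong (suc e) a≈b = *-cong a≈b (pow-cong e a≈b)

  monoProd-cong : ∀ {q} (es : Vec ℕ q) {x x′} → (∀ i → x i ≈ x′ i) →
                  monoProd es x ≈ monoProd es x′
  monoProd-cong {zero}  es x≈x′ = refl
  monoProd-cong {suc q} es x≈x′ =
    *-cong (pow-cong (lookup es Fin.zero) (x≈x′ Fin.zero)) (monoProd-cong (tail es) (x≈x′ ∘ Fin.suc))

  weightedSum-cong : ∀ {p} w (ms : List (Monomial p)) {x x′} → (∀ i → x i ≈ x′ i) →
                     weightedSum w ms x ≈ weightedSum w ms x′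
  weightedSum-cong w []       x≈x′ = refl
  weightedSum-cong w (m ∷ ms) x≈x′ =
    +-cong (*-cong refl (monoProd-cong (exps m) x≈x′)) (weightedSum-cong w ms x≈x′)

  ι+negPart : ∀ z → ι z + negPart z ≈ posPart z
  ι+negPart z = trans (+-cong (ι≈intR z) refl) (canonical z)
    where
    canonical : ∀ z → intR R z + negPart z ≈ posPart z
    canonical (+ n)    = +-identityʳ _
    canonical -[1+ n ] = -‿inverseˡ _

  eval+negative≈positive : ∀ {p} (D : Poly p) x →
                           eval D x + weightedSum negPart (monos D) x ≈ weightedSum posPart (monos D) x
  eval+negative≈positive D x = go (monos D)
    where
    go : ∀ ms → foldr (λ m s → evalMono m x + s) 0# ms + weightedSum negPart ms x ≈
                weightedSum posPart ms x
    go []       = +-identityʳ 0#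
    go (m ∷ ms) = trans (regroup (ι (coeff m)) (negPart (coeff m)) (monoProd (exps m) x) _ _)
                        (+-cong (*-cong (ι+negPart (coeff m)) refl) (go ms))
      where
      regroup : ∀ a b v s t → (a * v + s) + (b * v + t) ≈ (a + b) * v + (s + t)
      regroup = solve 5 (λ a b v s t → (a :* v :+ s) :+ (b :* v :+ t) := (a :+ b) :* v :+ (s :+ t)) refl

  root⇔positive≈negative : ∀ {p} (D : Poly p) x →
                           eval D x ≈ 0# ⇔ weightedSum posPart (monos D) x ≈ weightedSum negPart (monos D) x
  root⇔positive≈negative D x = mk⇔
    (λ root → trans (sym (eval+negative≈positive D x)) (trans (+-cong root refl) (+-identityˡ _)))
    (λ pos≈neg → +-cancelʳ (weightedSum negPart (monos D) x) _ _
                   (trans (eval+negative≈positive D x) (trans pos≈neg (sym (+-identityˡ _)))))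

  module ForPolynomial {p} (D : Poly p) where

    positive negative : (Fin p → Carrier) → Carrier
    positive = weightedSum posPart (monos D)
    negative = weightedSum negPart (monos D)

    unit≈1 : ∀ y → Satisfies y (program D) → y (unitVar p) ≈ 1#
    unit≈1 y sat =
      blockEquations⇒intended p unit y (proj₁ (satisfies-⨟ y (step unit done) (code₂ (termsOf D)) sat))
                              0 (s≤s z≤n)

    accumulators : ∀ y → Satisfies y (program D) →
                   y (outᵖ (polyC D)) ≈ 1# + positive (y ∘ toℕ) ×
                   y (outⁿ (polyC D)) ≈ 1# + negative (y ∘ toℕ)
    accumulators y sat =
      trans (proj₁ sums) (+-cong (unit≈1 y sat) refl) , trans (proj₂ sums) (+-cong (unit≈1 y sat) refl)
      where
      sums = termsC-computes (monos D) (p ℕ.+ 2) (m≤m+n p 2) (unitVar p) (unitVar p) (unitVar p)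
                             (unitVar< p) (unitVar< p) (unitVar< p) y (unit≈1 y sat)
                             (proj₂ (satisfies-⨟ y (step unit done) (code₂ (termsOf D)) sat))

    finalEquation⇔positive≈negative : ∀ x (y : ℕ → Carrier) → Satisfies y (program D) →
                                      (∀ i → y (toℕ i) ≈ x i) →
                                      Holds y (finalEquation D) ⇔ positive x ≈ negative x
    finalEquation⇔positive≈negative x y sat y≈x = mk⇔
      (λ final → +-cancelˡ 1# _ _ (begin
         1# + positive x                     ≈⟨ sym P≈ ⟩
         y (outᵖ (polyC D))                  ≈⟨ sym (trans (*-cong refl o≈1) (*-identityʳ _)) ⟩
         y (outᵖ (polyC D)) * y (unitVar p)  ≈⟨ final ⟩
         y (outⁿ (polyC D))                  ≈⟨ N≈ ⟩
         1# + negative x                     ∎))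
      (λ pos≈neg → begin
         y (outᵖ (polyC D)) * y (unitVar p)  ≈⟨ trans (*-cong refl o≈1) (*-identityʳ _) ⟩
         y (outᵖ (polyC D))                  ≈⟨ P≈ ⟩
         1# + positive x                     ≈⟨ +-cong refl pos≈neg ⟩
         1# + negative x                     ≈⟨ sym N≈ ⟩
         y (outⁿ (polyC D))                  ∎)
      where
      o≈1 = unit≈1 y sat
      P≈ = trans (proj₁ (accumulators y sat)) (+-cong refl (weightedSum-cong posPart (monos D) y≈x))
      N≈ = trans (proj₂ (accumulators y sat)) (+-cong refl (weightedSum-cong negPart (monos D) y≈x))

    finalEquation⇔root : ∀ x (y : ℕ → Carrier) → Satisfies y (program D) →
                         (∀ i → y (toℕ i) ≈ x i) →
                         Holds y (finalEquation D) ⇔ eval D x ≈ 0#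
    finalEquation⇔root x y sat y≈x =
      ⇔.trans (finalEquation⇔positive≈negative x y sat y≈x) (⇔.sym (root⇔positive≈negative D x))

    var : ℕ → Fin (nVars D)
    var = varOf D

    solves⇒satisfies : ∀ y → S.solves y (system D) → All (Holds (y ∘ var)) (systemℕ D)
    solves⇒satisfies y = All.map (λ {e} → holds e) ∘ All.map⁻
      where
      holds : ∀ e → S.holds y (toEquation var e) → Holds (y ∘ var) e
      holds (addOneℕ _ _) h = h
      holds (mulℕ _ _ _)  h = h

    satisfies⇒solves : ∀ y → All (Holds (y ∘ var)) (systemℕ D) → S.solves y (system D)
    satisfies⇒solves y = All.map⁺ ∘ All.map (λ {e} → holds e)
      where
      holds : ∀ e → Holds (y ∘ var) e → S.holds y (toEquation var e)
      holds (addOneℕ _ _) h = h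
      holds (mulℕ _ _ _)  h = h

    _extends_ : (Fin (nVars D) → Carrier) → (Fin p → Carrier) → Set ℓ
    y extends x = ∀ i → y (embedding D i) ≈ x i

    extends⇒ : ∀ y x → y extends x → ∀ i → y (var (toℕ i)) ≈ x i
    extends⇒ y x y≈x i = ≡.subst (λ j → y j ≈ x i) (≡.sym (varOf-toℕ D i)) (y≈x i)

    sound : ∀ x y → y extends x → S.solves y (system D) → eval D x ≈ 0#
    sound x y y≈x sol with All.++⁻ (equations (program D)) (solves⇒satisfies y sol)
    ... | sat , final ∷ [] = Equivalence.to (finalEquation⇔root x (y ∘ var) sat (extends⇒ y x y≈x)) final

    canonical : (Fin p → Carrier) → Fin (nVars D) → Carrier
    canonical x j = run (program D) (padded x 1#) (toℕ j)

    canonical-extends : ∀ x → canonical x extends x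
    canonical-extends x i = begin
      run (program D) (padded x 1#) (toℕ (embedding D i))
        ≡⟨ cong (run (program D) (padded x 1#)) (toℕ-inject≤ i _) ⟩
      run (program D) (padded x 1#) (toℕ i)
        ≡⟨ run-below (program D) (padded x 1#) (toℕ<n i) ⟩
      padded x 1# (toℕ i)
        ≡⟨ padded-toℕ x 1# i ⟩
      x i
        ∎

    canonical-solves : ∀ x → eval D x ≈ 0# → S.solves (canonical x) (system D)
    canonical-solves x root = satisfies⇒solves (canonical x) (All.++⁺ sat (final ∷ []))
      where
      sat : Satisfies (canonical x ∘ var) (program D)
      sat = run-satisfies (program D) (padded x 1#)
              (λ k k<n → reflexive (cong (run (program D) (padded x 1#)) (toℕ-clamp _ k<n)))
      final = Equivalence.from (finalEquation⇔root x _ sat (extends⇒ (canonical x) x (canonical-extends x))) root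

    solutions-unique : ∀ x y y′ → y extends x → y′ extends x →
                       S.solves y (system D) → S.solves y′ (system D) → ∀ j → y j ≈ y′ j
    solutions-unique x y y′ y≈x y′≈x sol sol′ j =
      ≡.subst₂ _≈_ (cong y (clamp-toℕ _ j)) (cong y′ (clamp-toℕ _ j))
        (satisfies-unique (program D) (sat y sol) (sat y′ sol′) agree (toℕ j) (toℕ<n j))
      where
      sat : ∀ y → S.solves y (system D) → Satisfies (y ∘ var) (program D)
      sat y sol = proj₁ (All.++⁻ (equations (program D)) (solves⇒satisfies y sol))
      agree : ∀ k → k < p → y (var k) ≈ y′ (var k)
      agree k k<p = ≡.subst (λ k → y (var k) ≈ y′ (var k)) (toℕ-fromℕ< k<p)
                      (trans (extends⇒ y x y≈x (fromℕ< k<p)) (sym (extends⇒ y′ x y′≈x (fromℕ< k<p))))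

    correct : Correct _≈_ (λ _ → ⊤) (embedding D) (λ x → eval D x ≈ 0#) (λ y → S.solves y (system D))
    correct =
      (λ x _ → mk⇔ (λ root → canonical x , (λ _ → tt) , canonical-extends x , canonical-solves x root)
                   (λ (y , _ , y≈x , sol) → sound x y y≈x sol)) ,
      (λ x _ root → canonical x , ((λ _ → tt) , canonical-extends x , canonical-solves x root) ,
                    λ y′ _ y′≈x sol′ → solutions-unique x (canonical x) y′ (canonical-extends x) y′≈x
                                                        (canonical-solves x root) sol′)

-- Correctness over ℕ and ℕ ∖ {0}, through ℤ

intR-ℤ : ∀ z → z ≡ intR +-*-commutativeRing z
intR-ℤ (+ n)    = natR-ℤ n
  where
  natR-ℤ : ∀ n → + n ≡ natR +-*-commutativeRing n
  natR-ℤ zero    = ≡.refl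
  natR-ℤ (suc n) = ≡.trans (pos-+ 1 n) (cong (ℤ._+_ (+ 1)) (natR-ℤ n))
intR-ℤ -[1+ n ] = cong ℤ.-_ (intR-ℤ (+ suc n))

module Sℕ = Solves _≡_ 1 ℕ._+_ ℕ._*_
module Sℤ = Solves _≡_ (+ 1) ℤ._+_ ℤ._*_

holds-toℤ : ∀ {n} (y : Fin n → ℕ) e → Sℕ.holds y e → Sℤ.holds (+_ ∘ y) e
holds-toℤ y (addOne i k) h = ≡.trans (≡.sym (pos-+ (y i) 1)) (cong +_ h)
holds-toℤ y (mul i j k)  h = ≡.trans (≡.sym (pos-* (y i) (y j))) (cong +_ h)

holds-fromℤ : ∀ {n} {y : Fin n → ℕ} {z} → (∀ j → + y j ≡ z j) → ∀ e → Sℤ.holds z e → Sℕ.holds y e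
holds-fromℤ {y = y} y≡z (addOne i k) h = +-injective (begin
  + (y i ℕ.+ 1)     ≡⟨ pos-+ (y i) 1 ⟩
  + y i ℤ.+ + 1     ≡⟨ cong (ℤ._+ + 1) (y≡z i) ⟩
  _                 ≡⟨ h ⟩
  _                 ≡⟨ ≡.sym (y≡z k) ⟩
  + y k             ∎)
  where open ≡.≡-Reasoning
holds-fromℤ {y = y} y≡z (mul i j k)  h = +-injective (begin
  + (y i ℕ.* y j)   ≡⟨ pos-* (y i) (y j) ⟩
  + y i ℤ.* + y j   ≡⟨ ≡.cong₂ ℤ._*_ (y≡z i) (y≡z j) ⟩
  _                 ≡⟨ h ⟩
  _                 ≡⟨ ≡.sym (y≡z k) ⟩
  + y k             ∎)
  where open ≡.≡-Reasoning

module NaturalCorrectness {k} (inK : ℕ → Set k) (inK-1 : inK 1)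
                          (inK-+ : ∀ {m m′} → inK m → inK m′ → inK (m ℕ.+ m′))
                          (inK-* : ∀ {m m′} → inK m → inK m′ → inK (m ℕ.* m′))
                          {p} (D : Poly p) where
  open RingCorrectness +-*-commutativeRing (λ z → z) intR-ℤ
  open ForPolynomial D using (canonical; canonical-extends; canonical-solves; sound; solutions-unique)
  open Eval (+ 0) (+ 1) ℤ._+_ ℤ._*_ (λ z → z) using (eval)

  LiftsK : ℤ → Set k
  LiftsK z = Σ ℕ λ m → inK m × + m ≡ z

  liftsK-+ : ∀ {u v} → LiftsK u → LiftsK v → LiftsK (u ℤ.+ v)
  liftsK-+ (m , m∈K , ≡.refl) (m′ , m′∈K , ≡.refl) = m ℕ.+ m′ , inK-+ m∈K m′∈K , pos-+ m m′

  liftsK-* : ∀ {u v} → LiftsK u → LiftsK v → LiftsK (u ℤ.* v)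
  liftsK-* (m , m∈K , ≡.refl) (m′ , m′∈K , ≡.refl) = m ℕ.* m′ , inK-* m∈K m′∈K , pos-* m m′

  open RingSemantics.Closure +-*-commutativeRing LiftsK (1 , inK-1 , ≡.refl) liftsK-+ liftsK-*
    using (run-closed)

  canonical-liftsK : ∀ x → (∀ i → inK (x i)) → ∀ j → LiftsK (canonical (+_ ∘ x) j)
  canonical-liftsK x x∈K j =
    run-closed (program D) (padded (+_ ∘ x) (+ 1))
               (padded-closed LiftsK (+_ ∘ x) (λ i → x i , x∈K i , ≡.refl) (1 , inK-1 , ≡.refl)) (toℕ j)

  solutionℕ : ∀ x → (∀ i → inK (x i)) → Fin (nVars D) → ℕ
  solutionℕ x x∈K j = proj₁ (canonical-liftsK x x∈K j)

  solutionℕ-inK : ∀ x x∈K j → inK (solutionℕ x x∈K j)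
  solutionℕ-inK x x∈K j = proj₁ (proj₂ (canonical-liftsK x x∈K j))

  solutionℕ-toℤ : ∀ x x∈K j → + solutionℕ x x∈K j ≡ canonical (+_ ∘ x) j
  solutionℕ-toℤ x x∈K j = proj₂ (proj₂ (canonical-liftsK x x∈K j))

  solutionℕ-extends : ∀ x x∈K i → solutionℕ x x∈K (embedding D i) ≡ x i
  solutionℕ-extends x x∈K i =
    +-injective (≡.trans (solutionℕ-toℤ x x∈K (embedding D i)) (canonical-extends (+_ ∘ x) i))

  solutionℕ-solves : ∀ x x∈K → eval D (+_ ∘ x) ≡ + 0 → Sℕ.solves (solutionℕ x x∈K) (system D)
  solutionℕ-solves x x∈K root =
    All.map (λ {e} → holds-fromℤ (solutionℕ-toℤ x x∈K) e) (canonical-solves (+_ ∘ x) root)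

  solves-toℤ : ∀ (y : Fin (nVars D) → ℕ) → Sℕ.solves y (system D) → Sℤ.solves (+_ ∘ y) (system D)
  solves-toℤ y = All.map (λ {e} → holds-toℤ y e)

  correct : Correct _≡_ inK (embedding D) (λ x → eval D (+_ ∘ x) ≡ + 0) (λ y → Sℕ.solves y (system D))
  correct =
    (λ x x∈K → mk⇔
      (λ root → solutionℕ x x∈K , solutionℕ-inK x x∈K , solutionℕ-extends x x∈K ,
                solutionℕ-solves x x∈K root)
      (λ (y , _ , y≡x , sol) → sound (+_ ∘ x) (+_ ∘ y) (cong +_ ∘ y≡x) (solves-toℤ y sol))) ,
    (λ x x∈K root → solutionℕ x x∈K ,
      (solutionℕ-inK x x∈K , solutionℕ-extends x x∈K , solutionℕ-solves x x∈K root) ,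
      λ y′ _ y′≡x sol′ j → +-injective
        (solutions-unique (+_ ∘ x) (+_ ∘ solutionℕ x x∈K) (+_ ∘ y′)
                          (cong +_ ∘ solutionℕ-extends x x∈K) (cong +_ ∘ y′≡x)
                          (solves-toℤ _ (solutionℕ-solves x x∈K root)) (solves-toℤ y′ sol′) j))

lemma4 : (p : ℕ) (D : Poly p) → (∀ (i : Fin p) → 1 ≤ deg D i) →
    Lemma4Conclusion p D
lemma4 p D _ = record
  { n        = nVars D
  ; p<n      = p<nVars D
  ; T        = system D
  ; forRings = λ R _ → RingCorrectness.ForPolynomial.correct R (intR R) (λ _ → CommutativeRing.refl R) D
  ; forℕ     = NaturalCorrectness.correct (λ _ → ⊤) tt (λ _ _ → tt) (λ _ _ → tt) D
  ; forℕ⁺    = NaturalCorrectness.correct (1 ≤_) (s≤s z≤n) (λ {m} 1≤m _ → ≤-trans 1≤m (m≤m+n m _))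
                                          *-mono-≤ D
  }
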